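{- Let $G$ be a finite simple undirected graph and let $H$ be a graph obtained from $G$ by inserting one edge between two non-adjacent distinct vertices or by deleting one edge. Then \[\operatorname{nlcw}(G)-2\le\operatorname{nlcw}(H)\le\operatorname{nlcw}(G)+2\quad\text{and}\quad \operatorname{cw}(G)-2\le\operatorname{cw}(H)\le\operatorname{cw}(G)+2.\]
   Context: Clique-width: for a positive integer $k$, $\mathrm{CW}_k$ is the smallest class of graphs whose vertices carry labels from $\{1,\dots,k\}$ that contains every single-vertex graph with any label and is closed under: disjoint union; relabeling $\rho_{a\to b}$ for $a\neq b$; and $\eta_{a,b}$ for $a\neq b$ (add all edges between vertices labeled $a$ and vertices labeled $b$). $\operatorname{cw}(G)$ is the least $k$ such that some labeling of $G$ lies in $\mathrm{CW}_k$. NLC-width: $\mathrm{NLC}_k$ is the smallest class of labeled graphs (labels in $\{1,\dots,k\}$) containing every single-vertex graph with any label and closed under: $G\times_S J$ for $S\subseteq\{1,\dots,k\}^2$ (disjoint union of vertex-disjoint $G$ and $J$ plus all edges $\{u,v\}$, $u\in V_G$, $v\in V_J$, $(\mathrm{lab}(u),\mathrm{lab}(v))\in S$); and $\circ_R$ for $R:\{1,\dots,k\}\to\{1,\dots,k\}$. $\operatorname{nlcw}(G)$ is the least $k$ such that some labeling of $G$ lies in $\mathrm{NLC}_k$. -}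

module Defs where

open import Data.Nat using (ℕ; _+_; _≤_)
open import Data.Fin using (Fin; splitAt; _≟_)
open import Data.Sum using (_⊎_; inj₁; inj₂)
open import Data.Bool using (Bool; true; false; _∧_; _∨_; not; if_then_else_)
open import Data.Product using (Σ; _×_; ∃)
open import Relation.Nullary using (¬_)
open import Relation.Nullary.Decidable using (⌊_⌋)
open import Relation.Binary.PropositionalEquality using (_≡_; _≢_)
open import Function.Bundles using (_↔_; Inverse)

record SimpleGraph (n : ℕ) : Set where
  field
    adj    : Fin n → Fin n → Bool
    sym    : ∀ i j → adj i j ≡ adj j i
    irrefl : ∀ i → adj i i ≡ false
open SimpleGraph public

_==_ : ∀ {m} → Fin m → Fin m → Bool
x == y = ⌊ x ≟ y ⌋

samePair : ∀ {n} → Fin n → Fin n → Fin n → Fin n → Bool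
samePair x y u v = ((x == u) ∧ (y == v)) ∨ ((x == v) ∧ (y == u))

InsertEdge : ∀ {n} → SimpleGraph n → SimpleGraph n → Set
InsertEdge {n} G H = Σ (Fin n) λ u → Σ (Fin n) λ v →
  (u ≢ v) × (adj G u v ≡ false) ×
  (∀ x y → adj H x y ≡ (adj G x y ∨ samePair x y u v))

DeleteEdge : ∀ {n} → SimpleGraph n → SimpleGraph n → Set
DeleteEdge {n} G H = Σ (Fin n) λ u → Σ (Fin n) λ v →
  (adj G u v ≡ true) ×
  (∀ x y → adj H x y ≡ (adj G x y ∧ not (samePair x y u v)))

OneEdgeEdit : ∀ {n} → SimpleGraph n → SimpleGraph n → Set
OneEdgeEdit G H = InsertEdge G H ⊎ DeleteEdge G H

unionAdj : ∀ s t → (Fin s → Fin s → Bool) → (Fin t → Fin t → Bool)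
         → (Fin s → Fin t → Bool) → Fin (s + t) → Fin (s + t) → Bool
unionAdj s t a b c x y with splitAt s x | splitAt s y
... | inj₁ i | inj₁ j = a i j
... | inj₂ i | inj₂ j = b i j
... | inj₁ i | inj₂ j = c i j
... | inj₂ i | inj₁ j = c j i

unionLab : ∀ {k} s t → (Fin s → Fin k) → (Fin t → Fin k) → Fin (s + t) → Fin k
unionLab s t f g x with splitAt s x
... | inj₁ i = f i
... | inj₂ j = g j

data CWExpr (k : ℕ) : Set where
  vtx  : Fin k → CWExpr k
  _⊕_  : CWExpr k → CWExpr k → CWExpr k
  ρ    : (a b : Fin k) → a ≢ b → CWExpr k → CWExpr k
  η    : (a b : Fin k) → a ≢ b → CWExpr k → CWExpr k

cwSize : ∀ {k} → CWExpr k → ℕ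
cwLab  : ∀ {k} (e : CWExpr k) → Fin (cwSize e) → Fin k
cwAdj  : ∀ {k} (e : CWExpr k) → Fin (cwSize e) → Fin (cwSize e) → Bool

cwSize (vtx a) = 1
cwSize (e ⊕ f) = cwSize e + cwSize f
cwSize (ρ a b _ e) = cwSize e
cwSize (η a b _ e) = cwSize e

cwLab (vtx a) _ = a
cwLab (e ⊕ f) = unionLab (cwSize e) (cwSize f) (cwLab e) (cwLab f)
cwLab (ρ a b _ e) x = if cwLab e x == a then b else cwLab e x
cwLab (η a b _ e) = cwLab e

cwAdj (vtx a) _ _ = false
cwAdj (e ⊕ f) = unionAdj (cwSize e) (cwSize f) (cwAdj e) (cwAdj f) (λ _ _ → false)
cwAdj (ρ a b _ e) = cwAdj e
cwAdj (η a b _ e) x y =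
  cwAdj e x y ∨ ((cwLab e x == a) ∧ (cwLab e y == b))
              ∨ ((cwLab e x == b) ∧ (cwLab e y == a))

data NLCExpr (k : ℕ) : Set where
  vtx   : Fin k → NLCExpr k
  join  : (S : Fin k → Fin k → Bool) → NLCExpr k → NLCExpr k → NLCExpr k
  relab : (R : Fin k → Fin k) → NLCExpr k → NLCExpr k

nlcSize : ∀ {k} → NLCExpr k → ℕ
nlcLab  : ∀ {k} (e : NLCExpr k) → Fin (nlcSize e) → Fin k
nlcAdj  : ∀ {k} (e : NLCExpr k) → Fin (nlcSize e) → Fin (nlcSize e) → Bool

nlcSize (vtx a) = 1
nlcSize (join S e f) = nlcSize e + nlcSize f
nlcSize (relab R e) = nlcSize e

nlcLab (vtx a) _ = a
nlcLab (join S e f) = unionLab (nlcSize e) (nlcSize f) (nlcLab e) (nlcLab f)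
nlcLab (relab R e) x = R (nlcLab e x)

nlcAdj (vtx a) _ _ = false
nlcAdj (join S e f) = unionAdj (nlcSize e) (nlcSize f) (nlcAdj e) (nlcAdj f)
                        (λ i j → S (nlcLab e i) (nlcLab f j))
nlcAdj (relab R e) = nlcAdj e

HasCW : ∀ {n} → ℕ → SimpleGraph n → Set
HasCW {n} k G = Σ (CWExpr k) λ e → Σ (Fin n ↔ Fin (cwSize e)) λ f →
  ∀ i j → adj G i j ≡ cwAdj e (Inverse.to f i) (Inverse.to f j)

HasNLCW : ∀ {n} → ℕ → SimpleGraph n → Set
HasNLCW {n} k G = Σ (NLCExpr k) λ e → Σ (Fin n ↔ Fin (nlcSize e)) λ f →
  ∀ i j → adj G i j ≡ nlcAdj e (Inverse.to f i) (Inverse.to f j)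

IsCW : ∀ {n} → SimpleGraph n → ℕ → Set
IsCW G k = HasCW k G × (∀ j → HasCW j G → k ≤ j)

IsNLCW : ∀ {n} → SimpleGraph n → ℕ → Set
IsNLCW G k = HasNLCW k G × (∀ j → HasNLCW j G → k ≤ j)

-- Fix a width-k expression for G and the endpoints u, v of the edited pair. Give u and v the
-- fresh labels 0 and 1 throughout the expression and shift every other label a to a + 2.
-- The label that u or v would carry at a node of the original expression is determined by the
-- node, so every operation can be simulated on the new labels, and only the adjacency of u and v
-- has to change. In an NLC-expression, u and v are separated by exactly one join, whose matrix
-- decides their adjacency through its entries (0,1) and (1,0); all other entries copy the
-- original matrix on the old labels. In a clique-width expression, each η a b becomes
-- η (a+2) (b+2) together with η's joining 0 (resp. 1) to b+2 or a+2 whenever u (resp. v) has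
-- label a or b; labels 0 and 1 are never joined, so the edge uv is deleted, and one final
-- η 0 1 inserts it instead. Both expressions use k + 2 labels, and applying this to the edit
-- and to its inverse bounds each width by the other plus 2.
module Submission where

open import Defs hiding (sym)
open import Data.Nat using (ℕ; _+_; _≤_)
open import Data.Nat.Properties using (+-comm)
open import Data.Fin using (Fin; zero; suc; _↑ˡ_; _↑ʳ_; splitAt; cast; _≟_)
open import Data.Fin.Properties
  using (splitAt-↑ˡ; splitAt-↑ʳ; splitAt⁻¹-↑ˡ; splitAt⁻¹-↑ʳ; ↑ˡ-injective; ↑ʳ-injective; suc-injective;
         cast-is-id; cast-involutive)
open import Data.Sum using (inj₁; inj₂; [_,_]′)
open import Data.Product using (_×_; _,_; Σ)
open import Data.Maybe using (Maybe; just; nothing; map; _>>=_)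
open import Data.Bool using (Bool; true; false; _∧_; _∨_; not; if_then_else_)
open import Data.Bool.Properties
  using (∨-comm; ∧-comm; ∨-assoc; ∨-zeroʳ; ∨-identityʳ; ∧-zeroʳ; ∧-identityʳ; if-float)
open import Data.Empty using (⊥-elim)
open import Relation.Nullary using (yes; no)
open import Function.Bundles using (_↔_; Inverse; Injection; mk↔ₛ′)
open import Function.Construct.Composition using (_↔-∘_)
open import Function.Definitions using (Injective)
open import Function.Properties.Inverse using (↔⇒↣)
open import Relation.Binary.PropositionalEquality

private variable
  k m n s t : ℕ

==-refl : (x : Fin n) → (x == x) ≡ true
==-refl x with x ≟ x
... | yes _  = refl
... | no x≢x = ⊥-elim (x≢x refl)

≢⇒==-false : {x y : Fin n} → x ≢ y → (x == y) ≡ false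
≢⇒==-false {x = x} {y} x≢y with x ≟ y
... | yes x≡y = ⊥-elim (x≢y x≡y)
... | no _    = refl

==⇒≡ : {x y : Fin n} → (x == y) ≡ true → x ≡ y
==⇒≡ {x = x} {y} x==y with x ≟ y
... | yes x≡y = x≡y

==-injective : (f : Fin m → Fin n) → Injective _≡_ _≡_ f → ∀ x y → (f x == f y) ≡ (x == y)
==-injective f f-inj x y with x ≟ y
... | yes refl = ==-refl (f x)
... | no x≢y   = ≢⇒==-false (λ fx≡fy → x≢y (f-inj fx≡fy))

==-ss : (x y : Fin m) → (suc (suc x) == suc (suc y)) ≡ (x == y)
==-ss = ==-injective (λ x → suc (suc x)) (λ eq → suc-injective (suc-injective eq))

ss-≢ : {a b : Fin k} → a ≢ b → suc (suc a) ≢ suc (suc b)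
ss-≢ a≢b eq = a≢b (suc-injective (suc-injective eq))

≢-if : ∀ c {X N M : Fin m} → X ≢ N → X ≢ M → X ≢ (if c then N else M)
≢-if true  X≢N _   = X≢N
≢-if false _   X≢M = X≢M

↑ˡ≢↑ʳ : (i : Fin s) (j : Fin t) → i ↑ˡ t ≢ s ↑ʳ j
↑ˡ≢↑ʳ {s} {t} i j i≡j with trans (sym (splitAt-↑ˡ s i t)) (trans (cong (splitAt s) i≡j) (splitAt-↑ʳ s t j))
... | ()

split-elim : (P : Fin (s + t) → Set) → (∀ i → P (i ↑ˡ t)) → (∀ j → P (s ↑ʳ j)) → ∀ z → P z
split-elim {s} {t} P left right z with splitAt s z in eq
... | inj₁ i rewrite sym (splitAt⁻¹-↑ˡ eq) = left i
... | inj₂ j rewrite sym (splitAt⁻¹-↑ʳ eq) = right j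

module _ (a : Fin s → Fin s → Bool) (b : Fin t → Fin t → Bool) (c : Fin s → Fin t → Bool) where

  unionAdj-↑ˡ↑ˡ : ∀ i i′ → unionAdj s t a b c (i ↑ˡ t) (i′ ↑ˡ t) ≡ a i i′
  unionAdj-↑ˡ↑ˡ i i′ rewrite splitAt-↑ˡ s i t | splitAt-↑ˡ s i′ t = refl

  unionAdj-↑ʳ↑ʳ : ∀ j j′ → unionAdj s t a b c (s ↑ʳ j) (s ↑ʳ j′) ≡ b j j′
  unionAdj-↑ʳ↑ʳ j j′ rewrite splitAt-↑ʳ s t j | splitAt-↑ʳ s t j′ = refl

  unionAdj-↑ˡ↑ʳ : ∀ i j → unionAdj s t a b c (i ↑ˡ t) (s ↑ʳ j) ≡ c i j
  unionAdj-↑ˡ↑ʳ i j rewrite splitAt-↑ˡ s i t | splitAt-↑ʳ s t j = refl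

  unionAdj-↑ʳ↑ˡ : ∀ i j → unionAdj s t a b c (s ↑ʳ j) (i ↑ˡ t) ≡ c i j
  unionAdj-↑ʳ↑ˡ i j rewrite splitAt-↑ˡ s i t | splitAt-↑ʳ s t j = refl

unionLab-↑ˡ : (f : Fin s → Fin k) (g : Fin t → Fin k) (i : Fin s) → unionLab s t f g (i ↑ˡ t) ≡ f i
unionLab-↑ˡ {s} {t = t} f g i rewrite splitAt-↑ˡ s i t = refl

unionLab-↑ʳ : (f : Fin s → Fin k) (g : Fin t → Fin k) (j : Fin t) → unionLab s t f g (s ↑ʳ j) ≡ g j
unionLab-↑ʳ {s} {t = t} f g j rewrite splitAt-↑ʳ s t j = refl

cast-↑ˡ : ∀ {s′ t′} (s≡s′ : s ≡ s′) (t≡t′ : t ≡ t′) (i : Fin s) →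
          cast (cong₂ _+_ s≡s′ t≡t′) (i ↑ˡ t) ≡ cast s≡s′ i ↑ˡ t′
cast-↑ˡ {t = t} refl refl i = trans (cast-is-id refl (i ↑ˡ t)) (cong (_↑ˡ t) (sym (cast-is-id refl i)))

cast-↑ʳ : ∀ {s′ t′} (s≡s′ : s ≡ s′) (t≡t′ : t ≡ t′) (j : Fin t) →
          cast (cong₂ _+_ s≡s′ t≡t′) (s ↑ʳ j) ≡ s′ ↑ʳ cast t≡t′ j
cast-↑ʳ {s = s} refl refl j = trans (cast-is-id refl (s ↑ʳ j)) (cong (s ↑ʳ_) (sym (cast-is-id refl j)))

cast-↔ : m ≡ n → Fin m ↔ Fin n
cast-↔ m≡n = mk↔ₛ′ (cast m≡n) (cast (sym m≡n)) (cast-involutive m≡n (sym m≡n)) (cast-involutive (sym m≡n) m≡n)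

-- An endpoint of the edited pair is located in a subexpression by its position there,
-- or by nothing if it lies outside.
_marks_ : Maybe (Fin n) → Fin n → Bool
nothing marks _ = false
just p  marks x = x == p

marks⇒≡ : (p : Maybe (Fin n)) {x : Fin n} → p marks x ≡ true → p ≡ just x
marks⇒≡ (just p) x==p = cong just (sym (==⇒≡ x==p))

restrictˡ : ∀ s t → Maybe (Fin (s + t)) → Maybe (Fin s)
restrictˡ s t p = p >>= λ z → [ just , (λ _ → nothing) ]′ (splitAt s z)

restrictʳ : ∀ s t → Maybe (Fin (s + t)) → Maybe (Fin t)
restrictʳ s t p = p >>= λ z → [ (λ _ → nothing) , just ]′ (splitAt s z)

marks-restrictˡ : (p : Maybe (Fin (s + t))) (i : Fin s) → restrictˡ s t p marks i ≡ p marks (i ↑ˡ t)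
marks-restrictˡ nothing i = refl
marks-restrictˡ {s} {t} (just z) i = split-elim (λ z → restrictˡ s t (just z) marks i ≡ (i ↑ˡ t) == z) left right z
  where
  left : ∀ i′ → restrictˡ s t (just (i′ ↑ˡ t)) marks i ≡ (i ↑ˡ t) == (i′ ↑ˡ t)
  left i′ rewrite splitAt-↑ˡ s i′ t = sym (==-injective (_↑ˡ t) (↑ˡ-injective t _ _) i i′)
  right : ∀ j → restrictˡ s t (just (s ↑ʳ j)) marks i ≡ (i ↑ˡ t) == (s ↑ʳ j)
  right j rewrite splitAt-↑ʳ s t j = sym (≢⇒==-false (↑ˡ≢↑ʳ i j))

marks-restrictʳ : (p : Maybe (Fin (s + t))) (j : Fin t) → restrictʳ s t p marks j ≡ p marks (s ↑ʳ j)
marks-restrictʳ nothing j = refl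
marks-restrictʳ {s} {t} (just z) j = split-elim (λ z → restrictʳ s t (just z) marks j ≡ (s ↑ʳ j) == z) left right z
  where
  left : ∀ i → restrictʳ s t (just (i ↑ˡ t)) marks j ≡ (s ↑ʳ j) == (i ↑ˡ t)
  left i rewrite splitAt-↑ˡ s i t = sym (≢⇒==-false (λ eq → ↑ˡ≢↑ʳ i j (sym eq)))
  right : ∀ j′ → restrictʳ s t (just (s ↑ʳ j′)) marks j ≡ (s ↑ʳ j) == (s ↑ʳ j′)
  right j′ rewrite splitAt-↑ʳ s t j′ = sym (==-injective (s ↑ʳ_) (↑ʳ-injective s _ _) j j′)

data Role : Set where
  first second other : Role

roleOf : Bool → Bool → Role
roleOf true  _     = first
roleOf false true  = second
roleOf false false = other

role : (p q : Maybe (Fin n)) → Fin n → Role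
role p q x = roleOf (p marks x) (q marks x)

role-restrictˡ : (p q : Maybe (Fin (s + t))) (i : Fin s) →
                 role (restrictˡ s t p) (restrictˡ s t q) i ≡ role p q (i ↑ˡ t)
role-restrictˡ p q i = cong₂ roleOf (marks-restrictˡ p i) (marks-restrictˡ q i)

role-restrictʳ : (p q : Maybe (Fin (s + t))) (j : Fin t) →
                 role (restrictʳ s t p) (restrictʳ s t q) j ≡ role p q (s ↑ʳ j)
role-restrictʳ p q j = cong₂ roleOf (marks-restrictʳ p j) (marks-restrictʳ q j)

isPair : Role → Role → Bool
isPair first  second = true
isPair second first  = true
isPair _      _      = false

isPair-comm : ∀ r r′ → isPair r r′ ≡ isPair r′ r
isPair-comm first  first  = refl
isPair-comm first  second = refl
isPair-comm first  other  = refl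
isPair-comm second first  = refl
isPair-comm second second = refl
isPair-comm second other  = refl
isPair-comm other  first  = refl
isPair-comm other  second = refl
isPair-comm other  other  = refl

isPair-irrefl : ∀ r → isPair r r ≡ false
isPair-irrefl first  = refl
isPair-irrefl second = refl
isPair-irrefl other  = refl

setPair : Role → Role → Bool → Bool → Bool
setPair r r′ β a = if isPair r r′ then β else a

setPair-cong : ∀ {r₁ r₂ r₁′ r₂′ β a₁ a₂} → r₁ ≡ r₂ → r₁′ ≡ r₂′ → a₁ ≡ a₂ →
               setPair r₁ r₁′ β a₁ ≡ setPair r₂ r₂′ β a₂
setPair-cong refl refl refl = refl

setPair-irrefl : ∀ r β a → setPair r r β a ≡ a
setPair-irrefl r β a rewrite isPair-irrefl r = refl

setPair-const : ∀ r r′ β → setPair r r′ β β ≡ β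
setPair-const r r′ β with isPair r r′
... | true  = refl
... | false = refl

setPair-∨ : ∀ r r′ a c → setPair r r′ false a ∨ setPair r r′ false c ≡ setPair r r′ false (a ∨ c)
setPair-∨ r r′ a c with isPair r r′
... | true  = refl
... | false = refl

setPair-∨-isPair : ∀ r r′ a → setPair r r′ false a ∨ isPair r r′ ≡ setPair r r′ true a
setPair-∨-isPair r r′ a with isPair r r′
... | true  = refl
... | false = ∨-identityʳ a

newLabel : Role → Fin k → Fin (2 + k)
newLabel first  _ = zero
newLabel second _ = suc zero
newLabel other  a = suc (suc a)

labelRole : Fin (2 + k) → Role
labelRole zero          = first
labelRole (suc zero)    = second
labelRole (suc (suc _)) = other

labelRole-newLabel : ∀ r (a : Fin k) → labelRole (newLabel r a) ≡ r
labelRole-newLabel first  a = refl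
labelRole-newLabel second a = refl
labelRole-newLabel other  a = refl

oldLabel : (lu lv : Maybe (Fin k)) → Fin (2 + k) → Maybe (Fin k)
oldLabel lu lv zero          = lu
oldLabel lu lv (suc zero)    = lv
oldLabel lu lv (suc (suc a)) = just a

oldLabelOf : (Fin n → Fin k) → (p q : Maybe (Fin n)) → Fin (2 + k) → Maybe (Fin k)
oldLabelOf L p q = oldLabel (map L p) (map L q)

oldLabelOf-newLabel : (L : Fin n → Fin k) (p q : Maybe (Fin n)) (x : Fin n) →
                      oldLabelOf L p q (newLabel (role p q x) (L x)) ≡ just (L x)
oldLabelOf-newLabel L p q x with p marks x in p∋x | q marks x in q∋x
... | true  | _     = cong (map L) (marks⇒≡ p p∋x)
... | false | true  = cong (map L) (marks⇒≡ q q∋x)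
... | false | false = refl

liftMap : (Fin k → Fin k) → Fin (2 + k) → Fin (2 + k)
liftMap R zero          = zero
liftMap R (suc zero)    = suc zero
liftMap R (suc (suc a)) = suc (suc (R a))

liftMap-newLabel : (R : Fin k → Fin k) → ∀ r a → liftMap R (newLabel r a) ≡ newLabel r (R a)
liftMap-newLabel R first  a = refl
liftMap-newLabel R second a = refl
liftMap-newLabel R other  a = refl

relabel-newLabel : ∀ r (a b c : Fin k) →
  (if newLabel r c == suc (suc a) then suc (suc b) else newLabel r c) ≡ newLabel r (if c == a then b else c)
relabel-newLabel first  a b c = refl
relabel-newLabel second a b c = refl
relabel-newLabel other  a b c rewrite ==-ss c a = sym (if-float (λ d → suc (suc d)) (c == a))

module UnionTranslation {s t s′ t′ : ℕ} (s≡s′ : s ≡ s′) (t≡t′ : t ≡ t′) (p q : Maybe (Fin (s + t))) where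

  private
    pˡ = restrictˡ s t p
    qˡ = restrictˡ s t q
    pʳ = restrictʳ s t p
    qʳ = restrictʳ s t q

  ι : Fin (s + t) → Fin (s′ + t′)
  ι = cast (cong₂ _+_ s≡s′ t≡t′)

  ιˡ : Fin s → Fin s′
  ιˡ = cast s≡s′

  ιʳ : Fin t → Fin t′
  ιʳ = cast t≡t′

  unionLab-translate : (f : Fin s → Fin k) (g : Fin t → Fin k)
                       (f′ : Fin s′ → Fin (2 + k)) (g′ : Fin t′ → Fin (2 + k)) →
    (∀ i → f′ (ιˡ i) ≡ newLabel (role pˡ qˡ i) (f i)) →
    (∀ j → g′ (ιʳ j) ≡ newLabel (role pʳ qʳ j) (g j)) →
    ∀ z → unionLab s′ t′ f′ g′ (ι z) ≡ newLabel (role p q z) (unionLab s t f g z)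
  unionLab-translate f g f′ g′ f′≡ g′≡ = split-elim _ left right
    where
    open ≡-Reasoning
    left : ∀ i → unionLab s′ t′ f′ g′ (ι (i ↑ˡ t)) ≡ newLabel (role p q (i ↑ˡ t)) (unionLab s t f g (i ↑ˡ t))
    left i = begin
      unionLab s′ t′ f′ g′ (ι (i ↑ˡ t))
        ≡⟨ cong (unionLab s′ t′ f′ g′) (cast-↑ˡ s≡s′ t≡t′ i) ⟩
      unionLab s′ t′ f′ g′ (ιˡ i ↑ˡ t′)
        ≡⟨ unionLab-↑ˡ f′ g′ (ιˡ i) ⟩
      f′ (ιˡ i)
        ≡⟨ f′≡ i ⟩
      newLabel (role pˡ qˡ i) (f i)
        ≡⟨ cong₂ newLabel (role-restrictˡ p q i) (sym (unionLab-↑ˡ f g i)) ⟩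
      newLabel (role p q (i ↑ˡ t)) (unionLab s t f g (i ↑ˡ t)) ∎
    right : ∀ j → unionLab s′ t′ f′ g′ (ι (s ↑ʳ j)) ≡ newLabel (role p q (s ↑ʳ j)) (unionLab s t f g (s ↑ʳ j))
    right j = begin
      unionLab s′ t′ f′ g′ (ι (s ↑ʳ j))
        ≡⟨ cong (unionLab s′ t′ f′ g′) (cast-↑ʳ s≡s′ t≡t′ j) ⟩
      unionLab s′ t′ f′ g′ (s′ ↑ʳ ιʳ j)
        ≡⟨ unionLab-↑ʳ f′ g′ (ιʳ j) ⟩
      g′ (ιʳ j)
        ≡⟨ g′≡ j ⟩
      newLabel (role pʳ qʳ j) (g j)
        ≡⟨ cong₂ newLabel (role-restrictʳ p q j) (sym (unionLab-↑ʳ f g j)) ⟩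
      newLabel (role p q (s ↑ʳ j)) (unionLab s t f g (s ↑ʳ j)) ∎

  unionAdj-translate : (β : Bool) (a : Fin s → Fin s → Bool) (b : Fin t → Fin t → Bool) (c : Fin s → Fin t → Bool)
    (a′ : Fin s′ → Fin s′ → Bool) (b′ : Fin t′ → Fin t′ → Bool) (c′ : Fin s′ → Fin t′ → Bool) →
    (∀ i i′ → a′ (ιˡ i) (ιˡ i′) ≡ setPair (role pˡ qˡ i) (role pˡ qˡ i′) β (a i i′)) →
    (∀ j j′ → b′ (ιʳ j) (ιʳ j′) ≡ setPair (role pʳ qʳ j) (role pʳ qʳ j′) β (b j j′)) →
    (∀ i j → c′ (ιˡ i) (ιʳ j) ≡ setPair (role pˡ qˡ i) (role pʳ qʳ j) β (c i j)) →
    ∀ z w → unionAdj s′ t′ a′ b′ c′ (ι z) (ι w) ≡ setPair (role p q z) (role p q w) β (unionAdj s t a b c z w)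
  unionAdj-translate β a b c a′ b′ c′ a′≡ b′≡ c′≡ =
    split-elim _ (λ i → split-elim _ (left-left i) (left-right i)) (λ j → split-elim _ (right-left j) (right-right j))
    where
    left-left : ∀ i i′ → unionAdj s′ t′ a′ b′ c′ (ι (i ↑ˡ t)) (ι (i′ ↑ˡ t))
                       ≡ setPair (role p q (i ↑ˡ t)) (role p q (i′ ↑ˡ t)) β (unionAdj s t a b c (i ↑ˡ t) (i′ ↑ˡ t))
    left-left i i′
      rewrite cast-↑ˡ s≡s′ t≡t′ i | cast-↑ˡ s≡s′ t≡t′ i′
            | unionAdj-↑ˡ↑ˡ a′ b′ c′ (ιˡ i) (ιˡ i′) | unionAdj-↑ˡ↑ˡ a b c i i′
      = trans (a′≡ i i′) (setPair-cong (role-restrictˡ p q i) (role-restrictˡ p q i′) refl)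
    right-right : ∀ j j′ → unionAdj s′ t′ a′ b′ c′ (ι (s ↑ʳ j)) (ι (s ↑ʳ j′))
                         ≡ setPair (role p q (s ↑ʳ j)) (role p q (s ↑ʳ j′)) β (unionAdj s t a b c (s ↑ʳ j) (s ↑ʳ j′))
    right-right j j′
      rewrite cast-↑ʳ s≡s′ t≡t′ j | cast-↑ʳ s≡s′ t≡t′ j′
            | unionAdj-↑ʳ↑ʳ a′ b′ c′ (ιʳ j) (ιʳ j′) | unionAdj-↑ʳ↑ʳ a b c j j′
      = trans (b′≡ j j′) (setPair-cong (role-restrictʳ p q j) (role-restrictʳ p q j′) refl)
    left-right : ∀ i j → unionAdj s′ t′ a′ b′ c′ (ι (i ↑ˡ t)) (ι (s ↑ʳ j))
                       ≡ setPair (role p q (i ↑ˡ t)) (role p q (s ↑ʳ j)) β (unionAdj s t a b c (i ↑ˡ t) (s ↑ʳ j))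
    left-right i j
      rewrite cast-↑ˡ s≡s′ t≡t′ i | cast-↑ʳ s≡s′ t≡t′ j
            | unionAdj-↑ˡ↑ʳ a′ b′ c′ (ιˡ i) (ιʳ j) | unionAdj-↑ˡ↑ʳ a b c i j
      = trans (c′≡ i j) (setPair-cong (role-restrictˡ p q i) (role-restrictʳ p q j) refl)
    right-left : ∀ j i → unionAdj s′ t′ a′ b′ c′ (ι (s ↑ʳ j)) (ι (i ↑ˡ t))
                       ≡ setPair (role p q (s ↑ʳ j)) (role p q (i ↑ˡ t)) β (unionAdj s t a b c (s ↑ʳ j) (i ↑ˡ t))
    right-left j i
      rewrite cast-↑ˡ s≡s′ t≡t′ i | cast-↑ʳ s≡s′ t≡t′ j
            | unionAdj-↑ʳ↑ˡ a′ b′ c′ (ιˡ i) (ιʳ j) | unionAdj-↑ʳ↑ˡ a b c i j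
            | isPair-comm (role p q (s ↑ʳ j)) (role p q (i ↑ˡ t))
      = trans (c′≡ i j) (setPair-cong (role-restrictˡ p q i) (role-restrictʳ p q j) refl)

-- NLC-width

liftRel : (Fin k → Fin k → Bool) → Maybe (Fin k) → Maybe (Fin k) → Bool
liftRel S (just a) (just c) = S a c
liftRel S _        _        = false

pairJoin : Bool → (Fin k → Fin k → Bool) → (oldˡ oldʳ : Fin (2 + k) → Maybe (Fin k)) →
           Fin (2 + k) → Fin (2 + k) → Bool
pairJoin β S oldˡ oldʳ X Y = setPair (labelRole X) (labelRole Y) β (liftRel S (oldˡ X) (oldʳ Y))

pairJoin-newLabel : ∀ β (S : Fin k → Fin k → Bool) oldˡ oldʳ r r′ {x y} →
  oldˡ (newLabel r x) ≡ just x → oldʳ (newLabel r′ y) ≡ just y →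
  pairJoin β S oldˡ oldʳ (newLabel r x) (newLabel r′ y) ≡ setPair r r′ β (S x y)
pairJoin-newLabel β S oldˡ oldʳ r r′ {x} {y} x-old y-old
  rewrite labelRole-newLabel r x | labelRole-newLabel r′ y | x-old | y-old = refl

nlcSetPair : (e : NLCExpr k) (p q : Maybe (Fin (nlcSize e))) → Bool → NLCExpr (2 + k)
nlcSetPair (vtx a) p q β = vtx (newLabel (role p q zero) a)
nlcSetPair (join S e f) p q β =
  join (pairJoin β S (oldLabelOf (nlcLab e) pˡ qˡ) (oldLabelOf (nlcLab f) pʳ qʳ))
       (nlcSetPair e pˡ qˡ β) (nlcSetPair f pʳ qʳ β)
  where
  pˡ = restrictˡ (nlcSize e) (nlcSize f) p
  qˡ = restrictˡ (nlcSize e) (nlcSize f) q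
  pʳ = restrictʳ (nlcSize e) (nlcSize f) p
  qʳ = restrictʳ (nlcSize e) (nlcSize f) q
nlcSetPair (relab R e) p q β = relab (liftMap R) (nlcSetPair e p q β)

nlcSize-setPair : ∀ (e : NLCExpr k) p q β → nlcSize e ≡ nlcSize (nlcSetPair e p q β)
nlcSize-setPair (vtx a)      p q β = refl
nlcSize-setPair (join S e f) p q β = cong₂ _+_ (nlcSize-setPair e _ _ β) (nlcSize-setPair f _ _ β)
nlcSize-setPair (relab R e)  p q β = nlcSize-setPair e p q β

nlcEmbed : ∀ (e : NLCExpr k) p q β → Fin (nlcSize e) → Fin (nlcSize (nlcSetPair e p q β))
nlcEmbed e p q β = cast (nlcSize-setPair e p q β)

nlcLab-setPair : ∀ (e : NLCExpr k) p q β (x : Fin (nlcSize e)) →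
  nlcLab (nlcSetPair e p q β) (nlcEmbed e p q β x) ≡ newLabel (role p q x) (nlcLab e x)
nlcLab-setPair (vtx a) p q β zero = refl
nlcLab-setPair (join S e f) p q β =
  unionLab-translate (nlcLab e) (nlcLab f) _ _ (nlcLab-setPair e _ _ β) (nlcLab-setPair f _ _ β)
  where open UnionTranslation (nlcSize-setPair e _ _ β) (nlcSize-setPair f _ _ β) p q
nlcLab-setPair (relab R e) p q β x =
  trans (cong (liftMap R) (nlcLab-setPair e p q β x)) (liftMap-newLabel R (role p q x) (nlcLab e x))

nlcAdj-setPair : ∀ (e : NLCExpr k) p q β (x y : Fin (nlcSize e)) →
  nlcAdj (nlcSetPair e p q β) (nlcEmbed e p q β x) (nlcEmbed e p q β y) ≡ setPair (role p q x) (role p q y) β (nlcAdj e x y)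
nlcAdj-setPair (vtx a) p q β zero zero = sym (setPair-irrefl (role p q zero) β false)
nlcAdj-setPair (join S e f) p q β =
  unionAdj-translate β _ _ _ _ _ _ (nlcAdj-setPair e pˡ qˡ β) (nlcAdj-setPair f pʳ qʳ β) across
  where
  open UnionTranslation (nlcSize-setPair e _ _ β) (nlcSize-setPair f _ _ β) p q
  pˡ = restrictˡ (nlcSize e) (nlcSize f) p
  qˡ = restrictˡ (nlcSize e) (nlcSize f) q
  pʳ = restrictʳ (nlcSize e) (nlcSize f) p
  qʳ = restrictʳ (nlcSize e) (nlcSize f) q
  across : ∀ i j → pairJoin β S (oldLabelOf (nlcLab e) pˡ qˡ) (oldLabelOf (nlcLab f) pʳ qʳ)
                                 (nlcLab (nlcSetPair e pˡ qˡ β) (ιˡ i)) (nlcLab (nlcSetPair f pʳ qʳ β) (ιʳ j))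
                 ≡ setPair (role pˡ qˡ i) (role pʳ qʳ j) β (S (nlcLab e i) (nlcLab f j))
  across i j rewrite nlcLab-setPair e pˡ qˡ β i | nlcLab-setPair f pʳ qʳ β j =
    pairJoin-newLabel β S (oldLabelOf (nlcLab e) pˡ qˡ) (oldLabelOf (nlcLab f) pʳ qʳ) (role pˡ qˡ i) (role pʳ qʳ j)
      (oldLabelOf-newLabel (nlcLab e) pˡ qˡ i) (oldLabelOf-newLabel (nlcLab f) pʳ qʳ j)
nlcAdj-setPair (relab R e) p q β = nlcAdj-setPair e p q β

-- Clique-width

joins : Fin m → Fin m → Fin m → Fin m → Bool
joins a b X Y = ((X == a) ∧ (Y == b)) ∨ ((X == b) ∧ (Y == a))

joins-comm : (a b X Y : Fin m) → joins a b X Y ≡ joins a b Y X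
joins-comm a b X Y =
  trans (∨-comm ((X == a) ∧ (Y == b)) _) (cong₂ _∨_ (∧-comm (X == b) (Y == a)) (∧-comm (X == a) (Y == b)))

joins-swap : (a b X Y : Fin m) → joins a b X Y ≡ joins b a X Y
joins-swap a b X Y = ∨-comm ((X == a) ∧ (Y == b)) _

joins-irrefl : {a b : Fin m} → a ≢ b → ∀ X → joins a b X X ≡ false
joins-irrefl {a = a} {b} a≢b X with X ≟ a | X ≟ b
... | yes refl | yes refl = ⊥-elim (a≢b refl)
... | yes _    | no _     = refl
... | no _     | yes _    = refl
... | no _     | no _     = refl

joins-ifʳ : ∀ c (N M d X Y : Fin m) → joins d (if c then N else M) X Y ≡ (if c then joins d N X Y else joins d M X Y)
joins-ifʳ c N M d X Y = if-float (λ N → joins d N X Y) c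

joins-absent : (d N X Y : Fin m) → (X == N) ≡ false → (Y == N) ≡ false → joins d N X Y ≡ false
joins-absent d N X Y X≠N Y≠N rewrite X≠N | Y≠N = trans (∨-identityʳ _) (∧-zeroʳ (X == d))

joins-fresh-newLabel : ∀ r r′ (x y : Fin k) → joins zero (suc zero) (newLabel r x) (newLabel r′ y) ≡ isPair r r′
joins-fresh-newLabel first  first  x y = refl
joins-fresh-newLabel first  second x y = refl
joins-fresh-newLabel first  other  x y = refl
joins-fresh-newLabel second first  x y = refl
joins-fresh-newLabel second second x y = refl
joins-fresh-newLabel second other  x y = refl
joins-fresh-newLabel other  first  x y = refl
joins-fresh-newLabel other  second x y = refl
joins-fresh-newLabel other  other  x y = refl

_labelled_ : Maybe (Fin k) → Fin k → Bool
nothing labelled _ = false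
just c  labelled a = c == a

module _ (a b : Fin k) (lu lv : Maybe (Fin k)) where
  private
    A B : Fin (2 + k)
    A = suc (suc a)
    B = suc (suc b)

  pairEdges : Fin (2 + k) → Fin (2 + k) → Bool
  pairEdges X Y = joins A B X Y ∨ ((lu labelled a ∧ joins B zero X Y) ∨ ((lu labelled b ∧ joins A zero X Y)
                   ∨ ((lv labelled a ∧ joins B (suc zero) X Y) ∨ (lv labelled b ∧ joins A (suc zero) X Y))))

  pairEdges-comm : ∀ X Y → pairEdges X Y ≡ pairEdges Y X
  pairEdges-comm X Y =
    cong₂ _∨_ (joins-comm A B X Y)
     (cong₂ _∨_ (cong (lu labelled a ∧_) (joins-comm B zero X Y))
      (cong₂ _∨_ (cong (lu labelled b ∧_) (joins-comm A zero X Y))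
       (cong₂ _∨_ (cong (lv labelled a ∧_) (joins-comm B (suc zero) X Y))
                  (cong (lv labelled b ∧_) (joins-comm A (suc zero) X Y)))))

  pairEdges-first-other : ∀ {x} y → lu ≡ just x → pairEdges zero (suc (suc y)) ≡ joins a b x y
  pairEdges-first-other {x} y refl
    rewrite ==-ss y a | ==-ss y b | ∧-zeroʳ (lv labelled a) | ∧-zeroʳ (lv labelled b)
          | ∨-identityʳ ((x == b) ∧ (y == a)) = refl

  pairEdges-second-other : ∀ {x} y → lv ≡ just x → pairEdges (suc zero) (suc (suc y)) ≡ joins a b x y
  pairEdges-second-other {x} y refl
    rewrite ==-ss y a | ==-ss y b | ∧-zeroʳ (lu labelled a) | ∧-zeroʳ (lu labelled b) = refl

  pairEdges-newLabel : a ≢ b → ∀ r r′ {x y} →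
                       oldLabel lu lv (newLabel r x) ≡ just x → oldLabel lu lv (newLabel r′ y) ≡ just y →
                       pairEdges (newLabel r x) (newLabel r′ y) ≡ setPair r r′ false (joins a b x y)
  pairEdges-newLabel a≢b first  first  {x} refl refl
    rewrite ∧-zeroʳ (x == a) | ∧-zeroʳ (x == b) | ∧-zeroʳ (lv labelled a) | ∧-zeroʳ (lv labelled b)
    = sym (joins-irrefl a≢b x)
  pairEdges-newLabel a≢b first  second {x} {y} refl refl
    rewrite ∧-zeroʳ (x == a) | ∧-zeroʳ (x == b) | ∧-zeroʳ (y == a) | ∧-zeroʳ (y == b) = refl
  pairEdges-newLabel a≢b first  other  {y = y} x-old _ = pairEdges-first-other y x-old
  pairEdges-newLabel a≢b second first  {x} {y} refl refl
    rewrite ∧-zeroʳ (x == a) | ∧-zeroʳ (x == b) | ∧-zeroʳ (y == a) | ∧-zeroʳ (y == b) = refl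
  pairEdges-newLabel a≢b second second {x} refl refl
    rewrite ∧-zeroʳ (x == a) | ∧-zeroʳ (x == b) | ∧-zeroʳ (lu labelled a) | ∧-zeroʳ (lu labelled b)
    = sym (joins-irrefl a≢b x)
  pairEdges-newLabel a≢b second other  {y = y} x-old _ = pairEdges-second-other y x-old
  pairEdges-newLabel a≢b other  first  {x} {y} _ y-old =
    trans (pairEdges-comm (suc (suc x)) zero) (trans (pairEdges-first-other x y-old) (joins-comm a b y x))
  pairEdges-newLabel a≢b other  second {x} {y} _ y-old =
    trans (pairEdges-comm (suc (suc x)) (suc zero)) (trans (pairEdges-second-other x y-old) (joins-comm a b y x))
  pairEdges-newLabel a≢b other  other  {x} {y} _ _
    rewrite joins-absent B zero (suc (suc x)) (suc (suc y)) refl refl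
          | joins-absent A zero (suc (suc x)) (suc (suc y)) refl refl
          | ∧-zeroʳ (lu labelled a) | ∧-zeroʳ (lu labelled b) | ∧-zeroʳ (lv labelled a) | ∧-zeroʳ (lv labelled b)
          | ==-ss x a | ==-ss x b | ==-ss y a | ==-ss y b = ∨-identityʳ _

if-else-false : ∀ c z → (if c then z else false) ≡ c ∧ z
if-else-false true  z = refl
if-else-false false z = refl

absorb-conditionals : ∀ {a t e₁ e₂ e₃ e₄} c₁ c₂ c₃ c₄ z₁ z₂ z₃ z₄ →
  e₁ ≡ (if c₁ then z₁ else t) → e₂ ≡ (if c₂ then z₂ else t) →
  e₃ ≡ (if c₃ then z₃ else t) → e₄ ≡ (if c₄ then z₄ else t) →
  ((((a ∨ e₁) ∨ e₂) ∨ e₃) ∨ e₄) ∨ t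
  ≡ a ∨ (t ∨ ((c₁ ∧ z₁) ∨ ((c₂ ∧ z₂) ∨ ((c₃ ∧ z₃) ∨ (c₄ ∧ z₄)))))
absorb-conditionals {a} {true} _ _ _ _ _ _ _ _ _ _ _ _ = trans (∨-zeroʳ _) (sym (∨-zeroʳ a))
absorb-conditionals {a} {false} c₁ c₂ c₃ c₄ z₁ z₂ z₃ z₄ refl refl refl refl
  rewrite if-else-false c₁ z₁ | if-else-false c₂ z₂ | if-else-false c₃ z₃ | if-else-false c₄ z₄ = begin
    ((((a ∨ w₁) ∨ w₂) ∨ w₃) ∨ w₄) ∨ false ≡⟨ ∨-identityʳ _ ⟩
    (((a ∨ w₁) ∨ w₂) ∨ w₃) ∨ w₄           ≡⟨ ∨-assoc ((a ∨ w₁) ∨ w₂) w₃ w₄ ⟩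
    ((a ∨ w₁) ∨ w₂) ∨ (w₃ ∨ w₄)           ≡⟨ ∨-assoc (a ∨ w₁) w₂ (w₃ ∨ w₄) ⟩
    (a ∨ w₁) ∨ (w₂ ∨ (w₃ ∨ w₄))           ≡⟨ ∨-assoc a w₁ (w₂ ∨ (w₃ ∨ w₄)) ⟩
    a ∨ (w₁ ∨ (w₂ ∨ (w₃ ∨ w₄)))           ∎
  where
  open ≡-Reasoning
  w₁ = c₁ ∧ z₁
  w₂ = c₂ ∧ z₂
  w₃ = c₃ ∧ z₃
  w₄ = c₄ ∧ z₄

-- When an endpoint does not carry the label in question, its conditional η falls back to a copy
-- of η (a+2) (b+2); this keeps the size of the expression independent of the labels.
ηPair : (a b : Fin k) → a ≢ b → (lu lv : Maybe (Fin k)) → CWExpr (2 + k) → CWExpr (2 + k)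
ηPair a b a≢b lu lv e =
  η A B A≢B
    (η A (if lv labelled b then suc zero else B) (≢-if (lv labelled b) (λ ()) A≢B)
      (η B (if lv labelled a then suc zero else A) (≢-if (lv labelled a) (λ ()) (≢-sym A≢B))
        (η A (if lu labelled b then zero else B) (≢-if (lu labelled b) (λ ()) A≢B)
          (η B (if lu labelled a then zero else A) (≢-if (lu labelled a) (λ ()) (≢-sym A≢B)) e))))
  where
  A = suc (suc a)
  B = suc (suc b)
  A≢B = ss-≢ a≢b

ηPair-adj : ∀ (a b : Fin k) a≢b lu lv (e : CWExpr (2 + k)) x y →
  cwAdj (ηPair a b a≢b lu lv e) x y ≡ cwAdj e x y ∨ pairEdges a b lu lv (cwLab e x) (cwLab e y)
ηPair-adj a b a≢b lu lv e x y =
  absorb-conditionals {cwAdj e x y} (lu labelled a) (lu labelled b) (lv labelled a) (lv labelled b)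
    (joins B zero X Y) (joins A zero X Y) (joins B (suc zero) X Y) (joins A (suc zero) X Y)
    (trans (joins-ifʳ (lu labelled a) zero A B X Y)
           (cong (if lu labelled a then joins B zero X Y else_) (joins-swap B A X Y)))
    (joins-ifʳ (lu labelled b) zero B A X Y)
    (trans (joins-ifʳ (lv labelled a) (suc zero) A B X Y)
           (cong (if lv labelled a then joins B (suc zero) X Y else_) (joins-swap B A X Y)))
    (joins-ifʳ (lv labelled b) (suc zero) B A X Y)
  where
  A = suc (suc a)
  B = suc (suc b)
  X = cwLab e x
  Y = cwLab e y

cwCut : (e : CWExpr k) (p q : Maybe (Fin (cwSize e))) → CWExpr (2 + k)
cwCut (vtx a) p q = vtx (newLabel (role p q zero) a)
cwCut (e ⊕ f) p q =
  cwCut e (restrictˡ (cwSize e) (cwSize f) p) (restrictˡ (cwSize e) (cwSize f) q) ⊕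
  cwCut f (restrictʳ (cwSize e) (cwSize f) p) (restrictʳ (cwSize e) (cwSize f) q)
cwCut (ρ a b a≢b e) p q = ρ (suc (suc a)) (suc (suc b)) (ss-≢ a≢b) (cwCut e p q)
cwCut (η a b a≢b e) p q = ηPair a b a≢b (map (cwLab e) p) (map (cwLab e) q) (cwCut e p q)

cwSize-cut : ∀ (e : CWExpr k) p q → cwSize e ≡ cwSize (cwCut e p q)
cwSize-cut (vtx a)       p q = refl
cwSize-cut (e ⊕ f)       p q = cong₂ _+_ (cwSize-cut e _ _) (cwSize-cut f _ _)
cwSize-cut (ρ a b a≢b e) p q = cwSize-cut e p q
cwSize-cut (η a b a≢b e) p q = cwSize-cut e p q

cwEmbed : ∀ (e : CWExpr k) p q → Fin (cwSize e) → Fin (cwSize (cwCut e p q))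
cwEmbed e p q = cast (cwSize-cut e p q)

cwLab-cut : ∀ (e : CWExpr k) p q (x : Fin (cwSize e)) →
  cwLab (cwCut e p q) (cwEmbed e p q x) ≡ newLabel (role p q x) (cwLab e x)
cwLab-cut (vtx a) p q zero = refl
cwLab-cut (e ⊕ f) p q =
  unionLab-translate (cwLab e) (cwLab f) _ _ (cwLab-cut e _ _) (cwLab-cut f _ _)
  where open UnionTranslation (cwSize-cut e _ _) (cwSize-cut f _ _) p q
cwLab-cut (ρ a b a≢b e) p q x =
  trans (cong (λ X → if X == suc (suc a) then suc (suc b) else X) (cwLab-cut e p q x))
        (relabel-newLabel (role p q x) a b (cwLab e x))
cwLab-cut (η a b a≢b e) p q = cwLab-cut e p q

cwAdj-cut : ∀ (e : CWExpr k) p q (x y : Fin (cwSize e)) →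
  cwAdj (cwCut e p q) (cwEmbed e p q x) (cwEmbed e p q y) ≡ setPair (role p q x) (role p q y) false (cwAdj e x y)
cwAdj-cut (vtx a) p q zero zero = sym (setPair-irrefl (role p q zero) false false)
cwAdj-cut (e ⊕ f) p q =
  unionAdj-translate false _ _ _ _ _ _ (cwAdj-cut e _ _) (cwAdj-cut f _ _) (λ i j → sym (setPair-const _ _ false))
  where open UnionTranslation (cwSize-cut e _ _) (cwSize-cut f _ _) p q
cwAdj-cut (ρ a b a≢b e) p q = cwAdj-cut e p q
cwAdj-cut (η a b a≢b e) p q x y = begin
  cwAdj (ηPair a b a≢b lu lv (cwCut e p q)) (ι x) (ι y)
    ≡⟨ ηPair-adj a b a≢b lu lv (cwCut e p q) (ι x) (ι y) ⟩
  cwAdj (cwCut e p q) (ι x) (ι y) ∨ pairEdges a b lu lv (cwLab (cwCut e p q) (ι x)) (cwLab (cwCut e p q) (ι y))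
    ≡⟨ cong₂ _∨_ (cwAdj-cut e p q x y) (cong₂ (pairEdges a b lu lv) (cwLab-cut e p q x) (cwLab-cut e p q y)) ⟩
  setPair rx ry false (cwAdj e x y) ∨ pairEdges a b lu lv (newLabel rx (cwLab e x)) (newLabel ry (cwLab e y))
    ≡⟨ cong (setPair rx ry false (cwAdj e x y) ∨_)
            (pairEdges-newLabel a b lu lv a≢b rx ry (oldLabelOf-newLabel (cwLab e) p q x)
                                                    (oldLabelOf-newLabel (cwLab e) p q y)) ⟩
  setPair rx ry false (cwAdj e x y) ∨ setPair rx ry false (joins a b (cwLab e x) (cwLab e y))
    ≡⟨ setPair-∨ rx ry _ _ ⟩
  setPair rx ry false (cwAdj (η a b a≢b e) x y) ∎
  where
  open ≡-Reasoning
  lu = map (cwLab e) p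
  lv = map (cwLab e) q
  ι = cwEmbed e p q
  rx = role p q x
  ry = role p q y

cwSetPair : (e : CWExpr k) (p q : Maybe (Fin (cwSize e))) → Bool → CWExpr (2 + k)
cwSetPair e p q false = cwCut e p q
cwSetPair e p q true  = η zero (suc zero) (λ ()) (cwCut e p q)

cwSize-setPair : ∀ (e : CWExpr k) p q β → cwSize e ≡ cwSize (cwSetPair e p q β)
cwSize-setPair e p q false = cwSize-cut e p q
cwSize-setPair e p q true  = cwSize-cut e p q

cwAdj-setPair : ∀ (e : CWExpr k) p q β (x y : Fin (cwSize e)) →
  cwAdj (cwSetPair e p q β) (cast (cwSize-setPair e p q β) x) (cast (cwSize-setPair e p q β) y)
  ≡ setPair (role p q x) (role p q y) β (cwAdj e x y)
cwAdj-setPair e p q false x y = cwAdj-cut e p q x y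
cwAdj-setPair e p q true  x y = begin
  cwAdj (cwCut e p q) (ι x) (ι y) ∨ joins zero (suc zero) (cwLab (cwCut e p q) (ι x)) (cwLab (cwCut e p q) (ι y))
    ≡⟨ cong₂ _∨_ (cwAdj-cut e p q x y) (cong₂ (joins zero (suc zero)) (cwLab-cut e p q x) (cwLab-cut e p q y)) ⟩
  setPair rx ry false (cwAdj e x y) ∨ joins zero (suc zero) (newLabel rx (cwLab e x)) (newLabel ry (cwLab e y))
    ≡⟨ cong (setPair rx ry false (cwAdj e x y) ∨_) (joins-fresh-newLabel rx ry (cwLab e x) (cwLab e y)) ⟩
  setPair rx ry false (cwAdj e x y) ∨ isPair rx ry
    ≡⟨ setPair-∨-isPair rx ry (cwAdj e x y) ⟩
  setPair rx ry true (cwAdj e x y) ∎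
  where
  open ≡-Reasoning
  ι = cwEmbed e p q
  rx = role p q x
  ry = role p q y

endpointRole : (u v x : Fin n) → Role
endpointRole u v x = roleOf (x == u) (x == v)

samePair-isPair : {u v : Fin n} → u ≢ v → ∀ x y → samePair x y u v ≡ isPair (endpointRole u v x) (endpointRole u v y)
samePair-isPair {u = u} {v} u≢v x y with x ≟ u | x ≟ v | y ≟ u | y ≟ v
... | yes x≡u | yes x≡v | _       | _       = ⊥-elim (u≢v (trans (sym x≡u) x≡v))
... | _       | _       | yes y≡u | yes y≡v = ⊥-elim (u≢v (trans (sym y≡u) y≡v))
... | yes _   | no _    | yes _   | no _    = refl
... | yes _   | no _    | no _    | yes _   = refl
... | yes _   | no _    | no _    | no _    = refl
... | no _    | yes _   | yes _   | no _    = refl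
... | no _    | yes _   | no _    | yes _   = refl
... | no _    | yes _   | no _    | no _    = refl
... | no _    | no _    | yes _   | no _    = refl
... | no _    | no _    | no _    | yes _   = refl
... | no _    | no _    | no _    | no _    = refl

samePair-adj : (G : SimpleGraph n) {x y u v : Fin n} → samePair x y u v ≡ true → adj G x y ≡ adj G u v
samePair-adj G {x} {y} {u} {v} with x ≟ u | y ≟ v | x ≟ v | y ≟ u
... | yes refl | yes refl | _        | _        = λ _ → refl
... | _        | _        | yes refl | yes refl = λ _ → SimpleGraph.sym G _ _
... | no _     | _        | no _     | _        = λ ()
... | no _     | _        | yes _    | no _     = λ ()
... | yes _    | no _     | no _     | _        = λ ()
... | yes _    | no _     | yes _    | no _     = λ ()

record PairUpdate (G H : SimpleGraph n) : Set where
  field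
    u v        : Fin n
    value      : Bool
    u≢v        : u ≢ v
    adj-update : ∀ x y → adj H x y ≡ (if samePair x y u v then value else adj G x y)

pairUpdate-reverse : {G H : SimpleGraph n} → PairUpdate G H → PairUpdate H G
pairUpdate-reverse {G = G} {H} upd = record
  { u = u ; v = v ; value = adj G u v ; u≢v = u≢v ; adj-update = restore }
  where
  open PairUpdate upd
  restore : ∀ x y → adj G x y ≡ (if samePair x y u v then adj G u v else adj H x y)
  restore x y with samePair x y u v in same | adj-update x y
  ... | true  | _   = samePair-adj G same
  ... | false | H≡G = sym H≡G

oneEdgeEdit⇒pairUpdate : {G H : SimpleGraph n} → OneEdgeEdit G H → PairUpdate G H
oneEdgeEdit⇒pairUpdate {G = G} (inj₁ (u , v , u≢v , _ , H≡)) = record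
  { u = u ; v = v ; value = true ; u≢v = u≢v
  ; adj-update = λ x y → trans (H≡ x y) (∨-if (adj G x y) (samePair x y u v)) }
  where
  ∨-if : ∀ a c → a ∨ c ≡ (if c then true else a)
  ∨-if a true  = ∨-zeroʳ a
  ∨-if a false = ∨-identityʳ a
oneEdgeEdit⇒pairUpdate {G = G} (inj₂ (u , v , Guv , H≡)) = record
  { u = u ; v = v ; value = false ; u≢v = u≢v
  ; adj-update = λ x y → trans (H≡ x y) (∧-not-if (adj G x y) (samePair x y u v)) }
  where
  u≢v : u ≢ v
  u≢v refl with trans (sym Guv) (irrefl G u)
  ... | ()
  ∧-not-if : ∀ a c → a ∧ not c ≡ (if c then false else a)
  ∧-not-if a true  = ∧-zeroʳ a
  ∧-not-if a false = ∧-identityʳ a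

module Realise {G H : SimpleGraph n} (upd : PairUpdate G H) (f : Fin n ↔ Fin m) where
  open PairUpdate upd
  open Inverse f using (to)

  p q : Maybe (Fin m)
  p = just (to u)
  q = just (to v)

  role-to : ∀ i → role p q (to i) ≡ endpointRole u v i
  role-to i = cong₂ roleOf (==-injective to (Injection.injective (↔⇒↣ f)) i u)
                           (==-injective to (Injection.injective (↔⇒↣ f)) i v)

  realise : (A : Fin m → Fin m → Bool) → (∀ i j → adj G i j ≡ A (to i) (to j)) →
            ∀ {m′} (m≡m′ : m ≡ m′) (A′ : Fin m′ → Fin m′ → Bool) →
            (∀ x y → A′ (cast m≡m′ x) (cast m≡m′ y) ≡ setPair (role p q x) (role p q y) value (A x y)) →
            Σ (Fin n ↔ Fin m′) λ g → ∀ i j → adj H i j ≡ A′ (Inverse.to g i) (Inverse.to g j)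
  realise A G≡A m≡m′ A′ A′≡ = cast-↔ m≡m′ ↔-∘ f , λ i j → begin
    adj H i j
      ≡⟨ adj-update i j ⟩
    (if samePair i j u v then value else adj G i j)
      ≡⟨ cong₂ (if_then value else_) (samePair-isPair u≢v i j) (G≡A i j) ⟩
    setPair (endpointRole u v i) (endpointRole u v j) value (A (to i) (to j))
      ≡⟨ setPair-cong (sym (role-to i)) (sym (role-to j)) refl ⟩
    setPair (role p q (to i)) (role p q (to j)) value (A (to i) (to j))
      ≡⟨ sym (A′≡ (to i) (to j)) ⟩
    A′ (cast m≡m′ (to i)) (cast m≡m′ (to j)) ∎
    where open ≡-Reasoning

HasNLCW-update : {G H : SimpleGraph n} → PairUpdate G H → HasNLCW k G → HasNLCW (2 + k) H
HasNLCW-update upd (e , f , G≡e) =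
  nlcSetPair e p q value ,
  realise (nlcAdj e) G≡e (nlcSize-setPair e p q value) (nlcAdj (nlcSetPair e p q value)) (nlcAdj-setPair e p q value)
  where open PairUpdate upd using (value)
        open Realise upd f

HasCW-update : {G H : SimpleGraph n} → PairUpdate G H → HasCW k G → HasCW (2 + k) H
HasCW-update upd (e , f , G≡e) =
  cwSetPair e p q value ,
  realise (cwAdj e) G≡e (cwSize-setPair e p q value) (cwAdj (cwSetPair e p q value)) (cwAdj-setPair e p q value)
  where open PairUpdate upd using (value)
        open Realise upd f

least-widths-close : (Has : ℕ → SimpleGraph n → Set) →
  (∀ {k} {G H} → PairUpdate G H → Has k G → Has (2 + k) H) →
  ∀ {G H} → PairUpdate G H → ∀ a b →
  Has a G × (∀ j → Has j G → a ≤ j) → Has b H × (∀ j → Has j H → b ≤ j) → (a ≤ b + 2) × (b ≤ a + 2)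
least-widths-close Has update G→H a b (G-has , G-least) (H-has , H-least) =
  subst (a ≤_) (+-comm 2 b) (G-least (2 + b) (update (pairUpdate-reverse G→H) H-has)) ,
  subst (b ≤_) (+-comm 2 a) (H-least (2 + a) (update G→H G-has))

theorem8 : ∀ {n} (G H : SimpleGraph n) → OneEdgeEdit G H →
    (∀ a b → IsNLCW G a → IsNLCW H b → (a ≤ b + 2) × (b ≤ a + 2)) ×
    (∀ c d → IsCW G c → IsCW H d → (c ≤ d + 2) × (d ≤ c + 2))
theorem8 G H edit =
  least-widths-close HasNLCW HasNLCW-update G→H , least-widths-close HasCW HasCW-update G→H
  where
  G→H : PairUpdate G H
  G→H = oneEdgeEdit⇒pairUpdate edit
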